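{- The relation algebra $34_{65}$ has a representation over the cyclic group $\mathbb{Z}/3697\mathbb{Z}$. Concretely: there exist pairwise disjoint nonempty sets $A,B,C\subseteq\mathbb{Z}/3697\mathbb{Z}$ with $A\cup B\cup C=(\mathbb{Z}/3697\mathbb{Z})\setminus\{0\}$, each symmetric ($-A=A$, $-B=B$, $-C=C$), such that \[ A+A=\mathbb{Z}/3697\mathbb{Z},\quad A+B=A+C=(\mathbb{Z}/3697\mathbb{Z})\setminus\{0\},\quad B+B=\{0\}\cup A\cup B,\quad C+C=\{0\}\cup A\cup C,\quad B+C=A. \]
   Context: $34_{65}$ is the integral symmetric relation algebra with atoms $1',a,b,c$ (all symmetric) whose forbidden diversity cycles are exactly $bbc$ and $ccb$ (up to cycle symmetries); all other diversity cycles are allowed. A representation over a group $G$ assigns to atoms sets $\{0\},A,B,C$ partitioning $G$ and interprets each atom $x$ with set $X$ as the relation $\{(u,v): v-u\in X\}$; composition of such relations corresponds to the Minkowski sum $X+Y$, and the displayed equalities are exactly the requirement that relational composition match the composition of $34_{65}$. -}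

module Defs where

open import Data.Nat using (ℕ; NonZero; _+_; _∸_)
open import Data.Nat.DivMod using (_mod_)
open import Data.Fin using (Fin; toℕ)
open import Data.Fin.Subset using (Subset; _∈_; _∉_)
open import Data.Product using (Σ; _×_; ∃-syntax)
open import Data.Sum using (_⊎_)
open import Relation.Binary.PropositionalEquality using (_≡_; _≢_)
open import Function.Bundles using (_⇔_)
open import Data.Empty using (⊥)

module Cyclic (n : ℕ) .{{_ : NonZero n}} where

  G : Set
  G = Fin n

  0G : G
  0G = 0 mod n

  _⊕_ : G → G → G
  x ⊕ y = (toℕ x + toℕ y) mod n

  ⊖_ : G → G
  ⊖ x = (n ∸ toℕ x) mod n

  _∈[_+_] : G → Subset n → Subset n → Set
  z ∈[ X + Y ] = ∃[ x ] ∃[ y ] (x ∈ X × y ∈ Y × x ⊕ y ≡ z)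

  Symmetric : Subset n → Set
  Symmetric X = ∀ x → x ∈ X → ⊖ x ∈ X

  Nonempty : Subset n → Set
  Nonempty X = ∃[ x ] x ∈ X

  Disjoint : Subset n → Subset n → Set
  Disjoint X Y = ∀ x → x ∈ X → x ∈ Y → ⊥

  -- A representation of the relation algebra 34₆₅ over ℤ/nℤ:
  -- atoms 1', a, b, c interpreted by {0}, A, B, C.
  record Rep34₆₅ : Set where
    field
      A B C : Subset n
      A-nonempty : Nonempty A
      B-nonempty : Nonempty B
      C-nonempty : Nonempty C
      AB-disjoint : Disjoint A B
      AC-disjoint : Disjoint A C
      BC-disjoint : Disjoint B C
      union : ∀ z → (z ∈ A ⊎ z ∈ B ⊎ z ∈ C) ⇔ (z ≢ 0G)
      A-sym : Symmetric A
      B-sym : Symmetric B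
      C-sym : Symmetric C
      A+A : ∀ z → z ∈[ A + A ]
      A+B : ∀ z → z ∈[ A + B ] ⇔ (z ≢ 0G)
      A+C : ∀ z → z ∈[ A + C ] ⇔ (z ≢ 0G)
      B+B : ∀ z → z ∈[ B + B ] ⇔ (z ≡ 0G ⊎ z ∈ A ⊎ z ∈ B)
      C+C : ∀ z → z ∈[ C + C ] ⇔ (z ≡ 0G ⊎ z ∈ A ⊎ z ∈ C)
      B+C : ∀ z → z ∈[ B + C ] ⇔ (z ∈ A)

module Submission where

-- For the prime p = 3697 the group (ℤ/p)ˣ is cyclic of order 3696 = 24 · 154, so χ(x) = x¹⁵⁴
-- maps it onto the 24th roots of unity.  Colour 0 by ι, the kernel of χ (the subgroup of order 154)
-- by b, the coset χ⁻¹(−1) by c and the remaining 22 cosets by a.  Each colour class is symmetric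
-- because χ(−1) = 1, and for symmetric disjoint X, Y the sum X + Y avoids 0.  Everything else is a
-- finite check done by evaluation: X + Y ⊆ T by running over all pairs drawn from the enumerated
-- classes, and T ⊆ X + Y by finding, for every z ∈ T, some x ∈ X with z − x ∈ Y.

open import Defs
open import Data.Nat using (ℕ; NonZero; zero; suc; _+_; _∸_; _^_; _%_; _<_; _≤_; _≡ᵇ_; >-nonZero⁻¹)
open import Data.Nat.Properties
  using (+-assoc; +-comm; +-identityʳ; m+[n∸m]≡n; <⇒≤; allUpTo?; +-commutativeSemigroup)
open import Data.Nat.DivMod using (_mod_; m%n<n; m<n⇒m%n≡m; [m+n]%n≡m%n; %-distribˡ-+; m%n%n≡m%n)
open import Algebra.Properties.CommutativeSemigroup +-commutativeSemigroup using (x∙yz≈yx∙z; x∙yz≈z∙yx)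
open import Data.Fin using (Fin; toℕ; fromℕ<)
open import Data.Fin.Properties using (toℕ-fromℕ<; toℕ-injective; toℕ<n)
open import Data.Fin.Subset using (Subset; _∈_)
open import Data.Vec using (tabulate)
open import Data.Vec.Properties using (lookup∘tabulate; []=⇒lookup; lookup⇒[]=)
open import Data.Bool using (Bool; true; false; if_then_else_)
open import Data.List using (List; filter; upTo)
open import Data.List.Relation.Unary.All as All using (All)
open import Data.List.Relation.Unary.Any using (Any; any?)
open import Data.List.Membership.Propositional using (find) renaming (_∈_ to _∈ₗ_)
open import Data.List.Membership.Propositional.Properties using (∈-filter⁺; ∈-filter⁻; ∈-upTo⁺; ∈-upTo⁻)
open import Data.Product using (_×_; _,_)
open import Data.Sum using (_⊎_; inj₁; inj₂)
open import Data.Unit using (⊤; tt)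
open import Data.Empty using (⊥-elim)
open import Function using (_∘_)
open import Function.Bundles using (_⇔_; mk⇔; Equivalence)
open import Function.Construct.Symmetry using (⇔-sym)
open import Function.Construct.Composition using (_⇔-∘_)
open import Data.Sum.Function.Propositional using (_⊎-⇔_)
open import Relation.Binary.Definitions using (DecidableEquality)
open import Relation.Binary.PropositionalEquality
  using (_≡_; _≢_; refl; sym; trans; cong; subst; module ≡-Reasoning)
open import Relation.Nullary using (¬_; Dec; yes; no)
open import Relation.Nullary.Decidable using (⌊_⌋; map′; toWitness; fromWitness; _⊎-dec_; _→-dec_; ¬?)
open import Relation.Unary using (Decidable)
open import Data.Bool.Properties using (T-≡)

data Atom : Set where
  ι a b c : Atom

_≟_ : DecidableEquality Atom
ι ≟ ι = yes refl
ι ≟ a = no λ ()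
ι ≟ b = no λ ()
ι ≟ c = no λ ()
a ≟ ι = no λ ()
a ≟ a = yes refl
a ≟ b = no λ ()
a ≟ c = no λ ()
b ≟ ι = no λ ()
b ≟ a = no λ ()
b ≟ b = yes refl
b ≟ c = no λ ()
c ≟ ι = no λ ()
c ≟ a = no λ ()
c ≟ b = no λ ()
c ≟ c = yes refl

[m+n%d]%d≡[m+n]%d : ∀ m n d .{{_ : NonZero d}} → (m + n % d) % d ≡ (m + n) % d
[m+n%d]%d≡[m+n]%d m n d = begin
  (m + n % d) % d           ≡⟨ %-distribˡ-+ m (n % d) d ⟩
  (m % d + n % d % d) % d   ≡⟨ cong (λ r → (m % d + r) % d) (m%n%n≡m%n n d) ⟩
  (m % d + n % d) % d       ≡⟨ %-distribˡ-+ m n d ⟨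
  (m + n) % d               ∎
  where open ≡-Reasoning

module CyclicArithmetic (n : ℕ) .{{_ : NonZero n}} where
  open Cyclic n

  toℕ-mod : ∀ m → toℕ (m mod n) ≡ m % n
  toℕ-mod m = toℕ-fromℕ< (m%n<n m n)

  toℕ-0G : toℕ 0G ≡ 0
  toℕ-0G = trans (toℕ-mod 0) (m<n⇒m%n≡m (>-nonZero⁻¹ n))

  toℕ-⊕ : ∀ x y → toℕ (x ⊕ y) ≡ (toℕ x + toℕ y) % n
  toℕ-⊕ x y = toℕ-mod _

  toℕ-⊖ : ∀ x → toℕ (⊖ x) ≡ (n ∸ toℕ x) % n
  toℕ-⊖ x = toℕ-mod _

  _-ₙ_ : ℕ → ℕ → ℕ
  m -ₙ k = (m + (n ∸ k) % n) % n

  toℕ-⊕⊖ : ∀ z x → toℕ (z ⊕ (⊖ x)) ≡ toℕ z -ₙ toℕ x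
  toℕ-⊕⊖ z x = trans (toℕ-⊕ z (⊖ x)) (cong (λ r → (toℕ z + r) % n) (toℕ-⊖ x))

  ⊕-comm : ∀ x y → x ⊕ y ≡ y ⊕ x
  ⊕-comm x y = cong (_mod n) (+-comm (toℕ x) (toℕ y))

  [m+[k+[n∸k]]]%n≡m%n : ∀ m {k} → k ≤ n → (m + (k + (n ∸ k))) % n ≡ m % n
  [m+[k+[n∸k]]]%n≡m%n m k≤n = trans (cong (λ r → (m + r) % n) (m+[n∸m]≡n k≤n)) ([m+n]%n≡m%n m n)

  ⊕-⊖-cancel : ∀ x z → x ⊕ (z ⊕ (⊖ x)) ≡ z
  ⊕-⊖-cancel x z = toℕ-injective (begin
    toℕ (x ⊕ (z ⊕ (⊖ x)))                ≡⟨ toℕ-⊕ x _ ⟩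
    (X + toℕ (z ⊕ (⊖ x))) % n            ≡⟨ cong (λ r → (X + r) % n) (toℕ-⊕⊖ z x) ⟩
    (X + (Z + (n ∸ X) % n) % n) % n      ≡⟨ [m+n%d]%d≡[m+n]%d X _ n ⟩
    (X + (Z + (n ∸ X) % n)) % n          ≡⟨ cong (_% n) (x∙yz≈yx∙z X Z _) ⟩
    (Z + X + (n ∸ X) % n) % n            ≡⟨ [m+n%d]%d≡[m+n]%d (Z + X) _ n ⟩
    (Z + X + (n ∸ X)) % n                ≡⟨ cong (_% n) (+-assoc Z X _) ⟩
    (Z + (X + (n ∸ X))) % n              ≡⟨ [m+[k+[n∸k]]]%n≡m%n Z (<⇒≤ (toℕ<n x)) ⟩
    Z % n                                ≡⟨ m<n⇒m%n≡m (toℕ<n z) ⟩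
    Z                                    ∎)
    where
    open ≡-Reasoning
    X Z : ℕ
    X = toℕ x
    Z = toℕ z

  ⊕≡0G⇒≡⊖ : ∀ x y → x ⊕ y ≡ 0G → y ≡ ⊖ x
  ⊕≡0G⇒≡⊖ x y x⊕y≡0G = toℕ-injective (begin
    Y                                    ≡⟨ m<n⇒m%n≡m (toℕ<n y) ⟨
    Y % n                                ≡⟨ [m+[k+[n∸k]]]%n≡m%n Y (<⇒≤ (toℕ<n x)) ⟨
    (Y + (X + (n ∸ X))) % n              ≡⟨ cong (_% n) (x∙yz≈z∙yx Y X _) ⟩
    ((n ∸ X) + (X + Y)) % n              ≡⟨ [m+n%d]%d≡[m+n]%d (n ∸ X) _ n ⟨
    ((n ∸ X) + (X + Y) % n) % n          ≡⟨ cong (λ r → ((n ∸ X) + r) % n) x+y≡0 ⟩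
    ((n ∸ X) + 0) % n                    ≡⟨ cong (_% n) (+-identityʳ _) ⟩
    (n ∸ X) % n                          ≡⟨ toℕ-⊖ x ⟨
    toℕ (⊖ x)                            ∎)
    where
    open ≡-Reasoning
    X Y : ℕ
    X = toℕ x
    Y = toℕ y
    x+y≡0 : (X + Y) % n ≡ 0
    x+y≡0 = trans (sym (toℕ-⊕ x y)) (trans (cong toℕ x⊕y≡0G) toℕ-0G)

  sum-comm : ∀ {X Y z} → z ∈[ X + Y ] → z ∈[ Y + X ]
  sum-comm (x , y , x∈X , y∈Y , x⊕y≡z) = y , x , y∈Y , x∈X , trans (⊕-comm y x) x⊕y≡z

  0G∉sum : ∀ {X Y} → Symmetric X → Disjoint X Y → ¬ 0G ∈[ X + Y ]
  0G∉sum X-sym X∩Y≡∅ (x , y , x∈X , y∈Y , x⊕y≡0G) =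
    X∩Y≡∅ y (subst (_∈ _) (sym (⊕≡0G⇒≡⊖ x y x⊕y≡0G)) (X-sym x x∈X)) y∈Y

module Colouring (n : ℕ) .{{_ : NonZero n}} (colour : ℕ → Atom) where
  open Cyclic n
  open CyclicArithmetic n
  open Equivalence using (to; from)

  -- ⟦_⟧ is opaque, and Closed and Witnessed below are records, so that unification never unfolds
  -- them into computations over all of ℤ/nℤ.
  opaque
    ⟦_⟧ : Atom → Subset n
    ⟦ t ⟧ = tabulate λ x → ⌊ colour (toℕ x) ≟ t ⌋

    ∈⟦⟧⇔ : ∀ {t x} → x ∈ ⟦ t ⟧ ⇔ colour (toℕ x) ≡ t
    ∈⟦⟧⇔ {t} {x} = mk⇔
      (λ x∈t → toWitness (from T-≡ (trans (sym (lookup∘tabulate f x)) ([]=⇒lookup x∈t))))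
      (λ x↦t → lookup⇒[]= x ⟦ t ⟧ (trans (lookup∘tabulate f x) (to T-≡ (fromWitness x↦t))))
      where
      f : Fin n → Bool
      f y = ⌊ colour (toℕ y) ≟ t ⌋

  ⟦⟧-disjoint : ∀ {s t} → s ≢ t → Disjoint ⟦ s ⟧ ⟦ t ⟧
  ⟦⟧-disjoint s≢t x x∈s x∈t = s≢t (trans (sym (to ∈⟦⟧⇔ x∈s)) (to ∈⟦⟧⇔ x∈t))

  ιMarksZero : Set
  ιMarksZero = ∀ {m} → colour m ≡ ι ⇔ m ≡ 0

  colour≡ι⇔≡0G : ιMarksZero → ∀ {z} → colour (toℕ z) ≡ ι ⇔ z ≡ 0G
  colour≡ι⇔≡0G ι⇔0 = mk⇔
    (λ z↦ι → toℕ-injective (trans (to ι⇔0 z↦ι) (sym toℕ-0G)))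
    (λ { refl → from ι⇔0 toℕ-0G })

  ⟦⟧-cover : ιMarksZero → ∀ {z} → (z ∈ ⟦ a ⟧ ⊎ z ∈ ⟦ b ⟧ ⊎ z ∈ ⟦ c ⟧) ⇔ z ≢ 0G
  ⟦⟧-cover ι⇔0 {z} = mk⇔ nonzero cases
    where
    diversity≢0G : ∀ {t} → t ≢ ι → z ∈ ⟦ t ⟧ → z ≢ 0G
    diversity≢0G t≢ι z∈t z≡0G = t≢ι (trans (sym (to ∈⟦⟧⇔ z∈t)) (from (colour≡ι⇔≡0G ι⇔0) z≡0G))

    nonzero : z ∈ ⟦ a ⟧ ⊎ z ∈ ⟦ b ⟧ ⊎ z ∈ ⟦ c ⟧ → z ≢ 0G
    nonzero (inj₁ z∈a) = diversity≢0G (λ ()) z∈a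
    nonzero (inj₂ (inj₁ z∈b)) = diversity≢0G (λ ()) z∈b
    nonzero (inj₂ (inj₂ z∈c)) = diversity≢0G (λ ()) z∈c

    cases : z ≢ 0G → z ∈ ⟦ a ⟧ ⊎ z ∈ ⟦ b ⟧ ⊎ z ∈ ⟦ c ⟧
    cases z≢0G with colour (toℕ z) in z↦
    ... | ι = ⊥-elim (z≢0G (to (colour≡ι⇔≡0G ι⇔0) z↦))
    ... | a = inj₁ (from ∈⟦⟧⇔ z↦)
    ... | b = inj₂ (inj₁ (from ∈⟦⟧⇔ z↦))
    ... | c = inj₂ (inj₂ (from ∈⟦⟧⇔ z↦))

  ColourSymmetric : Set
  ColourSymmetric = ∀ {m} → m < n → colour ((n ∸ m) % n) ≡ colour m

  ⟦⟧-symmetric : ColourSymmetric → ∀ t → Symmetric ⟦ t ⟧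
  ⟦⟧-symmetric symm t x x∈t =
    from ∈⟦⟧⇔ (trans (cong colour (toℕ-⊖ x)) (trans (symm (toℕ<n x)) (to ∈⟦⟧⇔ x∈t)))

  elements : Atom → List ℕ
  elements t = filter (λ m → colour m ≟ t) (upTo n)

  ∈-elements⁻ : ∀ {t m} → m ∈ₗ elements t → m < n × colour m ≡ t
  ∈-elements⁻ {t} m∈t with m∈upTo , m↦t ← ∈-filter⁻ (λ m → colour m ≟ t) m∈t = ∈-upTo⁻ m∈upTo , m↦t

  toℕ∈elements : ∀ {t x} → x ∈ ⟦ t ⟧ → toℕ x ∈ₗ elements t
  toℕ∈elements {t} {x} x∈t = ∈-filter⁺ (λ m → colour m ≟ t) (∈-upTo⁺ (toℕ<n x)) (to ∈⟦⟧⇔ x∈t)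

  record Closed (P : Atom → Set) (s t : Atom) : Set where
    constructor closed
    field
      pairs : All (λ x → All (λ y → P (colour ((x + y) % n))) (elements t)) (elements s)

  record Witnessed (P : Atom → Set) (s t : Atom) : Set where
    constructor witnessed
    field
      witness : ∀ {m} → m < n → P (colour m) → Any (λ x → colour (m -ₙ x) ≡ t) (elements s)

  -- The enumerations are passed as arguments so that evaluation computes each of them only once.
  closed? : ∀ {P} → Decidable P → ∀ s t → Dec (Closed P s t)
  closed? {P} P? s t = map′ closed Closed.pairs (allPairs (elements s) (elements t))
    where
    allPairs : ∀ xs ys → Dec (All (λ x → All (λ y → P (colour ((x + y) % n))) ys) xs)
    allPairs xs ys = All.all? (λ x → All.all? (λ y → P? (colour ((x + y) % n))) ys) xs

  witnessed? : ∀ {P} → Decidable P → ∀ s t → Dec (Witnessed P s t)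
  witnessed? {P} P? s t = map′ witnessed Witnessed.witness (allWitnessed (elements s))
    where
    allWitnessed : ∀ xs → Dec (∀ {m} → m < n → P (colour m) → Any (λ x → colour (m -ₙ x) ≡ t) xs)
    allWitnessed xs = allUpTo? (λ m → P? (colour m) →-dec any? (λ x → colour (m -ₙ x) ≟ t) xs) n

  sum-closed : ∀ {P s t z} → Closed P s t → z ∈[ ⟦ s ⟧ + ⟦ t ⟧ ] → P (colour (toℕ z))
  sum-closed {P} P-closed (x , y , x∈s , y∈t , refl) =
    subst (λ r → P (colour r)) (sym (toℕ-⊕ x y))
      (All.lookup (All.lookup (Closed.pairs P-closed) (toℕ∈elements x∈s)) (toℕ∈elements y∈t))

  sum-witnessed : ∀ {P s t z} → Witnessed P s t → P (colour (toℕ z)) → z ∈[ ⟦ s ⟧ + ⟦ t ⟧ ]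
  sum-witnessed {s = s} {t} {z} P-witnessed Pz
    with m , m∈s , z-m↦t ← find (Witnessed.witness P-witnessed (toℕ<n z) Pz)
    with m<n , m↦s ← ∈-elements⁻ m∈s
    = x , z ⊕ (⊖ x) , from ∈⟦⟧⇔ x↦s , from ∈⟦⟧⇔ z-x↦t , ⊕-⊖-cancel x z
    where
    x : Fin n
    x = fromℕ< m<n
    x↦s : colour (toℕ x) ≡ s
    x↦s = trans (cong colour (toℕ-fromℕ< m<n)) m↦s
    z-x↦t : colour (toℕ (z ⊕ (⊖ x))) ≡ t
    z-x↦t = trans (cong colour (trans (toℕ-⊕⊖ z x) (cong (toℕ z -ₙ_) (toℕ-fromℕ< m<n)))) z-m↦t

  sum-⇔ : ∀ {P s t z} → Closed P s t → Witnessed P s t → z ∈[ ⟦ s ⟧ + ⟦ t ⟧ ] ⇔ P (colour (toℕ z))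
  sum-⇔ P-closed P-witnessed = mk⇔ (sum-closed P-closed) (sum-witnessed P-witnessed)

  sum-⇔-≢0G : ιMarksZero → ColourSymmetric → ∀ {s t z} → s ≢ t → Witnessed (_≢ ι) t s →
              z ∈[ ⟦ s ⟧ + ⟦ t ⟧ ] ⇔ z ≢ 0G
  sum-⇔-≢0G ι⇔0 symm {s} s≢t ≢ι-witnessed = mk⇔
    (λ { z∈s+t refl → 0G∉sum (⟦⟧-symmetric symm s) (⟦⟧-disjoint s≢t) z∈s+t })
    (λ z≢0G → sum-comm (sum-witnessed ≢ι-witnessed (z≢0G ∘ to (colour≡ι⇔≡0G ι⇔0))))

p : ℕ
p = 3697

residueAtom : ℕ → Atom
residueAtom r = if r ≡ᵇ 1 then b else if r ≡ᵇ p ∸ 1 then c else a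

residueAtom≢ι : ∀ r → residueAtom r ≢ ι
residueAtom≢ι r with r ≡ᵇ 1 | r ≡ᵇ p ∸ 1
... | true  | _     = λ ()
... | false | true  = λ ()
... | false | false = λ ()

-- χ x ≡ x¹⁵⁴ (mod p), with the power split into small steps.  The leading x % p keeps colour (suc k)
-- from unfolding the power when k is a variable.
χ : ℕ → ℕ
χ x = (((x % p) ^ 2 % p) ^ 7 % p) ^ 11 % p

colour : ℕ → Atom
colour zero    = ι
colour (suc k) = residueAtom (χ (suc k))

open Cyclic p
open Colouring p colour

colour≡ι⇔≡0 : ιMarksZero
colour≡ι⇔≡0 {zero}  = mk⇔ (λ _ → refl) (λ _ → refl)
colour≡ι⇔≡0 {suc k} = mk⇔ (⊥-elim ∘ residueAtom≢ι (χ (suc k))) (λ ())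

colour-symmetric : ColourSymmetric
colour-symmetric = toWitness {a? = allUpTo? (λ m → colour ((p ∸ m) % p) ≟ colour m) p} _

A+A-witnessed : Witnessed (λ _ → ⊤) a a
A+A-witnessed = toWitness {a? = witnessed? (λ _ → yes tt) a a} _

B+A-witnessed : Witnessed (_≢ ι) b a
B+A-witnessed = toWitness {a? = witnessed? (λ u → ¬? (u ≟ ι)) b a} _

C+A-witnessed : Witnessed (_≢ ι) c a
C+A-witnessed = toWitness {a? = witnessed? (λ u → ¬? (u ≟ ι)) c a} _

B+B-closed : Closed (λ u → u ≡ ι ⊎ u ≡ a ⊎ u ≡ b) b b
B+B-closed = toWitness {a? = closed? (λ u → u ≟ ι ⊎-dec u ≟ a ⊎-dec u ≟ b) b b} _

B+B-witnessed : Witnessed (λ u → u ≡ ι ⊎ u ≡ a ⊎ u ≡ b) b b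
B+B-witnessed = toWitness {a? = witnessed? (λ u → u ≟ ι ⊎-dec u ≟ a ⊎-dec u ≟ b) b b} _

C+C-closed : Closed (λ u → u ≡ ι ⊎ u ≡ a ⊎ u ≡ c) c c
C+C-closed = toWitness {a? = closed? (λ u → u ≟ ι ⊎-dec u ≟ a ⊎-dec u ≟ c) c c} _

C+C-witnessed : Witnessed (λ u → u ≡ ι ⊎ u ≡ a ⊎ u ≡ c) c c
C+C-witnessed = toWitness {a? = witnessed? (λ u → u ≟ ι ⊎-dec u ≟ a ⊎-dec u ≟ c) c c} _

B+C-closed : Closed (_≡ a) b c
B+C-closed = toWitness {a? = closed? (_≟ a) b c} _

B+C-witnessed : Witnessed (_≡ a) b c
B+C-witnessed = toWitness {a? = witnessed? (_≟ a) b c} _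

mainTheorem6 : Cyclic.Rep34₆₅ 3697
mainTheorem6 = record
  { A = ⟦ a ⟧
  ; B = ⟦ b ⟧
  ; C = ⟦ c ⟧
  ; A-nonempty = 5 mod p , from ∈⟦⟧⇔ refl
  ; B-nonempty = 1 mod p , from ∈⟦⟧⇔ refl
  ; C-nonempty = 12 mod p , from ∈⟦⟧⇔ refl
  ; AB-disjoint = ⟦⟧-disjoint λ ()
  ; AC-disjoint = ⟦⟧-disjoint λ ()
  ; BC-disjoint = ⟦⟧-disjoint λ ()
  ; union = λ _ → ⟦⟧-cover colour≡ι⇔≡0
  ; A-sym = ⟦⟧-symmetric colour-symmetric a
  ; B-sym = ⟦⟧-symmetric colour-symmetric b
  ; C-sym = ⟦⟧-symmetric colour-symmetric c
  ; A+A = λ _ → sum-witnessed A+A-witnessed tt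
  ; A+B = λ _ → sum-⇔-≢0G colour≡ι⇔≡0 colour-symmetric (λ ()) B+A-witnessed
  ; A+C = λ _ → sum-⇔-≢0G colour≡ι⇔≡0 colour-symmetric (λ ()) C+A-witnessed
  ; B+B = λ _ → (zero⇔ ⊎-⇔ ⇔-sym ∈⟦⟧⇔ ⊎-⇔ ⇔-sym ∈⟦⟧⇔) ⇔-∘ sum-⇔ B+B-closed B+B-witnessed
  ; C+C = λ _ → (zero⇔ ⊎-⇔ ⇔-sym ∈⟦⟧⇔ ⊎-⇔ ⇔-sym ∈⟦⟧⇔) ⇔-∘ sum-⇔ C+C-closed C+C-witnessed
  ; B+C = λ _ → ⇔-sym ∈⟦⟧⇔ ⇔-∘ sum-⇔ B+C-closed B+C-witnessed
  }
  where
  open Equivalence using (from)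
  zero⇔ : ∀ {z} → colour (toℕ z) ≡ ι ⇔ z ≡ 0G
  zero⇔ = colour≡ι⇔≡0G colour≡ι⇔≡0
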